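{- Let $\mathcal{A}$ be a commutative algebra over a field $F$ with unit element $1$. Let $R_n, q_n\in\mathcal{A}$ for $n\geq 0$, with $q_0=1$, and set $q_n=0$ for $n<0$. For a partition $\mu=(\mu_1,\dots,\mu_r)$ put $q_\mu=q_{\mu_1}q_{\mu_2}\cdots q_{\mu_r}$. Assume that for each $n\geq 1$ there is $c_n\in F$ with $$\sum_{i\geq 1}R_i\,q_{n-i}=c_n\,q_n .$$ Then for every partition $\lambda=(\lambda_1,\dots,\lambda_s)$ of length $s$ (all $\lambda_j>0$) there exist coefficients $c_{\lambda\mu}\in F$, indexed by partitions $\mu$ of $|\lambda|$ with $\mu\geq\lambda$ in dominance order, such that $$\sum_{i_1,\dots,i_s\geq 1}R_{i_1+\cdots+i_s}\,q_{\lambda_1-i_1}\cdots q_{\lambda_s-i_s}=\sum_{\mu\geq\lambda}c_{\lambda\mu}\,q_\mu ,$$ where each $c_{\lambda\mu}$ is an integer linear combination of the elements $c_{\mu_1},c_{\mu_2},\dots$ (the $c$'s indexed by the parts of $\mu$), and $c_{\lambda\lambda}=(-1)^{l(\lambda)-1}c_{\lambda_s}$.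
   Context: A partition $\lambda=(\lambda_1,\lambda_2,\dots)$ is a weakly decreasing sequence of nonnegative integers with finitely many nonzero terms; $|\lambda|=\sum_i\lambda_i$ and $l(\lambda)$ is the number of nonzero parts. For partitions $\lambda,\mu$ of the same weight, the dominance order is $\mu\geq\lambda$ iff $\sum_{j\leq i}(\mu_j-\lambda_j)\geq 0$ for all $i$. -}

module Defs where

open import Level using (Level; _⊔_)
open import Algebra.Bundles using (CommutativeRing)
open import Algebra.Morphism.Structures using (IsRingHomomorphism)
open import Data.Nat using (ℕ; zero; suc; _∸_; _≤_)
import Data.Nat as ℕ
open import Data.Nat.ListAction using (sum)
open import Data.Integer using (ℤ; +_; -[1+_])
open import Data.List using (List; []; _∷_; take; length; map; zipWith)
open import Data.List.Relation.Unary.All using (All)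
open import Data.List.Relation.Unary.Linked using (Linked)
open import Data.Product using (Σ; _×_; ∃; _,_)
open import Relation.Nullary using (¬_)
open import Relation.Binary.PropositionalEquality using (_≡_)

IsPartition : List ℕ → Set
IsPartition μ = Linked (λ x y → y ≤ x) μ × All (λ x → 1 ≤ x) μ

weight : List ℕ → ℕ
weight = sum

-- sum of the first i parts (parts beyond the length count as 0)
partialSum : List ℕ → ℕ → ℕ
partialSum μ i = sum (take i μ)

-- μ ≥ λ in dominance order (for partitions of the same weight)
Dominates : List ℕ → List ℕ → Set
Dominates μ λ′ = ∀ i → partialSum λ′ i ≤ partialSum μ i

-- last part λ_s of a list (0 for the empty list; only used for nonempty ones)
lastPart : List ℕ → ℕ
lastPart []           = 0
lastPart (x ∷ [])     = x
lastPart (x ∷ y ∷ xs) = lastPart (y ∷ xs)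

record IsField {c ℓ : Level} (F : CommutativeRing c ℓ) : Set (c ⊔ ℓ) where
  open CommutativeRing F
  field
    0≉1     : ¬ (0# ≈ 1#)
    inverse : ∀ x → ¬ (x ≈ 0#) → ∃ λ y → x * y ≈ 1#

-- A commutative F-algebra with unit: a commutative ring A together with a
-- (unital) ring homomorphism ι : F → A; the scalar action is c · a = ι c * a.
record IsAlgebraMap {c ℓ a ℓ′ : Level} (F : CommutativeRing c ℓ)
                    (A : CommutativeRing a ℓ′)
                    (ι : CommutativeRing.Carrier F → CommutativeRing.Carrier A)
                    : Set (c ⊔ ℓ ⊔ a ⊔ ℓ′) where
  field
    isRingHom : IsRingHomomorphism (CommutativeRing.rawRing F)
                                   (CommutativeRing.rawRing A) ι

module _ {c ℓ : Level} (R : CommutativeRing c ℓ) where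
  open CommutativeRing R

  sumFrom1 : ℕ → (ℕ → Carrier) → Carrier
  sumFrom1 zero    f = 0#
  sumFrom1 (suc n) f = sumFrom1 n f + f (suc n)

  natScale : ℕ → Carrier → Carrier
  natScale zero    x = 0#
  natScale (suc n) x = natScale n x + x

  intScale : ℤ → Carrier → Carrier
  intScale (+ n)     x = natScale n x
  intScale -[1+ n ] x = - natScale (suc n) x

  signPow : ℕ → Carrier → Carrier
  signPow zero    x = x
  signPow (suc n) x = - signPow n x

  intLinComb : List ℤ → List Carrier → Carrier
  intLinComb zs cs = foldr′ (zipWith intScale zs cs)
    where
      foldr′ : List Carrier → Carrier
      foldr′ []       = 0#
      foldr′ (x ∷ xs) = x + foldr′ xs

  IsIntLinComb : Carrier → List Carrier → Set ℓ
  IsIntLinComb a cs = Σ (List ℤ) λ zs → length zs ≡ length cs × a ≈ intLinComb zs cs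

  qProd : (ℕ → Carrier) → List ℕ → Carrier
  qProd q []       = 1#
  qProd q (m ∷ μ) = q m * qProd q μ

  -- ∑_{i₁,…,i_s ≥ 1} R_{acc + i₁+⋯+i_s} q_{λ₁-i₁} ⋯ q_{λ_s-i_s}
  -- Terms with some i_j > λ_j vanish (q_n = 0 for n < 0), so i_j ranges
  -- over 1 … λ_j.
  multiSum : (ℕ → Carrier) → (ℕ → Carrier) → List ℕ → ℕ → Carrier
  multiSum Rs q []        acc = Rs acc
  multiSum Rs q (l ∷ λ′) acc =
    sumFrom1 l (λ i → q (l ∸ i) * multiSum Rs q λ′ (acc ℕ.+ i))

  combo : ∀ {c′ ℓ″} (F : CommutativeRing c′ ℓ″) →
          (CommutativeRing.Carrier F → Carrier) → (ℕ → Carrier) →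
          List (List ℕ × CommutativeRing.Carrier F) → Carrier
  combo F ι q []              = 0#
  combo F ι q ((μ , a) ∷ ts) = ι a * qProd q μ + combo F ι q ts

module Submission where

-- For λ = (λ₁, …, λ_s) consider the multiple sum
--   X λ = ∑_{i₁,…,i_s ≥ 1} R_{i₁+⋯+i_s} q_{λ₁-i₁} ⋯ q_{λ_s-i_s}.
-- An exchange of two finite sums (Exchange) gives, for λ = (a, m, b+1),
--   X λ = X(a+1, m, b) + q_b X(a+1, m) − q_a X(m, b+1)      (X-recursion),
-- while X(x) = c_x q_x is the hypothesis.  Induction on the length of λ and,
-- for fixed length, on the last part then expands X λ in the q_μ
-- (Expansions): the first two summands only produce partitions dominating
-- (a+1, m, b), hence strictly above λ; in the last one the part a is added to
-- each term of X(m, b+1) (q_a q_μ = q_{μ ∪ a}), and only μ = (m, b+1) gives back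
-- λ, with coefficient −c_{(m,b+1),(m,b+1)} — whence c_{λλ} = (−1)^{s−1} c_{λ_s}.
-- Adding a part keeps a coefficient in the ℤ-span of the c's of the parts, and
-- collecting equal partitions at the end makes them unique.

open import Defs
open import Level using (Level; 0ℓ; _⊔_)
open import Algebra.Bundles using (CommutativeRing)
open import Algebra.Morphism.Structures using (module IsRingHomomorphism)
open import Data.Bool using (true; false)
open import Data.Empty using (⊥-elim)
open import Data.Nat as ℕ using (ℕ; zero; suc; _∸_; _≤_; _<_; _≤?_; z≤n; s≤s)
import Data.Nat.Properties as ℕP
open import Data.Nat.ListAction.Properties using (sum-↭)
open import Data.Integer as ℤ using (+_; -[1+_]; _⊖_)
import Data.Integer.Properties as ℤP
open import Data.List using (List; []; _∷_; _++_; length; map; zipWith; foldr; initLast; _∷ʳ′_)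
import Data.List.Properties as ListP
open import Data.List.Relation.Unary.All as All using (All; []; _∷_)
import Data.List.Relation.Unary.All.Properties as AllP
open import Data.List.Relation.Unary.AllPairs using ([]; _∷_)
open import Data.List.Relation.Unary.Any using (here)
open import Data.List.Relation.Unary.Linked as Linked using (Linked; []; [-]; _∷_)
open import Data.List.Relation.Unary.Unique.Propositional using (Unique)
open import Data.List.Relation.Unary.Sorted.TotalOrder.Properties using (↗↭↗⇒≋)
open import Data.List.Membership.Propositional using (_∈_)
open import Data.List.Relation.Binary.Permutation.Propositional as ↭
  using (_↭_; ↭-sym; ↭-trans; ↭-reflexive; ↭⇒↭ₛ′)
import Data.List.Relation.Binary.Permutation.Propositional.Properties as ↭P
open import Data.List.Relation.Binary.Pointwise as Pointwise using (Pointwise-≡⇒≡)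
open import Data.Product using (Σ; _×_; _,_; proj₁; proj₂)
open import Relation.Binary.Bundles using (DecTotalOrder)
import Relation.Binary.Construct.Flip.Ord as Flip
open import Relation.Nullary using (¬_; yes; no)
open import Relation.Binary.PropositionalEquality as ≡ using (_≡_)
import Algebra.Properties.Ring as RingProperties
import Algebra.Properties.CommutativeSemigroup
import Algebra.Solver.CommutativeMonoid as CommutativeMonoidSolver

module FiniteSums {a ℓ : Level} (A : CommutativeRing a ℓ) where
  open CommutativeRing A
  open Algebra.Properties.CommutativeSemigroup +-commutativeSemigroup
    using () renaming (interchange to +-interchange)

  ∑ : ℕ → (ℕ → Carrier) → Carrier
  ∑ = sumFrom1 A

  ∑-cong : ∀ n {f g} → (∀ i → f i ≈ g i) → ∑ n f ≈ ∑ n g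
  ∑-cong zero    f≈g = refl
  ∑-cong (suc n) f≈g = +-cong (∑-cong n f≈g) (f≈g (suc n))

  ∑-zeros : ∀ n → ∑ n (λ _ → 0#) ≈ 0#
  ∑-zeros zero    = refl
  ∑-zeros (suc n) = trans (+-identityʳ _) (∑-zeros n)

  ∑-+ : ∀ n f g → ∑ n (λ i → f i + g i) ≈ ∑ n f + ∑ n g
  ∑-+ zero    f g = sym (+-identityʳ 0#)
  ∑-+ (suc n) f g = trans (+-congʳ (∑-+ n f g)) (+-interchange _ _ _ _)

  *-∑ : ∀ n x f → x * ∑ n f ≈ ∑ n (λ i → x * f i)
  *-∑ zero    x f = zeroʳ x
  *-∑ (suc n) x f = trans (distribˡ x _ _) (+-congʳ (*-∑ n x f))

  ∑-comm : ∀ n k (f : ℕ → ℕ → Carrier) →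
           ∑ n (λ i → ∑ k (f i)) ≈ ∑ k (λ j → ∑ n (λ i → f i j))
  ∑-comm zero    k f = sym (∑-zeros k)
  ∑-comm (suc n) k f = trans (+-congʳ (∑-comm n k f)) (sym (∑-+ k _ _))

  ∑-peel : ∀ n f → ∑ (suc n) f ≈ f 1 + ∑ n (λ i → f (suc i))
  ∑-peel zero    f = trans (+-identityˡ _) (sym (+-identityʳ _))
  ∑-peel (suc n) f = trans (+-congʳ (∑-peel n f)) (+-assoc _ _ _)

-- For q, G : ℕ → A write
--   P n   = ∑_{i=1}^{n} q_{n-i} G_i ,
--   T a b = ∑_{i=1}^{a} q_{a-i} ∑_{j=1}^{b} q_{b-j} G_{i+j} .
-- Peeling off the term j = 1 of T a (b+1), resp. i = 1 of T (a+1) b, leaves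
-- the same double sum in both cases, whence
--   T a (b+1) + q_a P (b+1) = T (a+1) b + q_b P (a+1).
module Exchange {a ℓ : Level} (A : CommutativeRing a ℓ)
                (q G : ℕ → CommutativeRing.Carrier A) where
  open CommutativeRing A
  open import Relation.Binary.Reasoning.Setoid setoid
  open FiniteSums A
  open Algebra.Properties.CommutativeSemigroup *-commutativeSemigroup
    using () renaming (x∙yz≈y∙xz to *-swapˡ)

  inner : ℕ → ℕ → Carrier
  inner b i = ∑ b (λ j → q (b ∸ j) * G (i ℕ.+ j))

  oneIndex : ℕ → Carrier
  oneIndex n = ∑ n (λ i → q (n ∸ i) * G i)

  twoIndex : ℕ → ℕ → Carrier
  twoIndex a b = ∑ a (λ i → q (a ∸ i) * inner b i)

  -- the double sum left over after peeling, common to both sides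
  common : ℕ → ℕ → Carrier
  common a b = ∑ a (λ i → q (a ∸ i) * inner b (suc i))

  inner-peel : ∀ b i → inner (suc b) i ≈ q b * G (suc i) + inner b (suc i)
  inner-peel b i = trans (∑-peel b _)
    (+-cong (*-congˡ (reflexive (≡.cong G (ℕP.+-comm i 1))))
            (∑-cong b (λ j → *-congˡ (reflexive (≡.cong G (ℕP.+-suc i j))))))

  twoIndex-peelˡ : ∀ a b → twoIndex (suc a) b ≈ q a * inner b 1 + common a b
  twoIndex-peelˡ a b = ∑-peel a _

  oneIndex-peel : ∀ n → oneIndex (suc n) ≈ q n * G 1 + inner n 1
  oneIndex-peel n = ∑-peel n _

  twoIndex-peelʳ : ∀ a b → twoIndex a (suc b) ≈ q b * inner a 1 + common a b
  twoIndex-peelʳ a b = begin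
    ∑ a (λ i → q (a ∸ i) * inner (suc b) i)
      ≈⟨ ∑-cong a (λ i → trans (*-congˡ (inner-peel b i)) (trans (distribˡ _ _ _) (+-congʳ (*-swapˡ _ _ _)))) ⟩
    ∑ a (λ i → q b * (q (a ∸ i) * G (suc i)) + q (a ∸ i) * inner b (suc i))
      ≈⟨ ∑-+ a _ _ ⟩
    ∑ a (λ i → q b * (q (a ∸ i) * G (suc i))) + common a b
      ≈⟨ +-congʳ (sym (*-∑ a _ _)) ⟩
    q b * inner a 1 + common a b ∎

  exchange : ∀ a b → twoIndex a (suc b) + q a * oneIndex (suc b)
                   ≈ twoIndex (suc a) b + q b * oneIndex (suc a)
  exchange a b = begin
    twoIndex a (suc b) + q a * oneIndex (suc b)
      ≈⟨ +-cong (twoIndex-peelʳ a b) (*-congˡ (oneIndex-peel b)) ⟩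
    (q b * inner a 1 + common a b) + q a * (q b * G 1 + inner b 1)
      ≈⟨ symmetric (q a) (q b) _ _ _ _ ⟩
    (q a * inner b 1 + common a b) + q b * (q a * G 1 + inner a 1)
      ≈⟨ sym (+-cong (twoIndex-peelˡ a b) (*-congˡ (oneIndex-peel a))) ⟩
    twoIndex (suc a) b + q b * oneIndex (suc a) ∎
    where
    module CM = CommutativeMonoidSolver +-commutativeMonoid
    open CM using (_⊕_; _⊜_)
    -- (y u + c) + x (y g + v)  is symmetric under  (x, u) ↔ (y, v)
    symmetric : ∀ x y u v g c → (y * u + c) + x * (y * g + v) ≈ (x * v + c) + y * (x * g + u)
    symmetric x y u v g c = begin
      (y * u + c) + x * (y * g + v)       ≈⟨ +-congˡ (trans (distribˡ x _ _) (+-congʳ (*-swapˡ x y g))) ⟩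
      (y * u + c) + (y * (x * g) + x * v)
        ≈⟨ CM.solve 4 (λ yu c′ yxg xv → (yu ⊕ c′) ⊕ (yxg ⊕ xv) ⊜ (xv ⊕ c′) ⊕ (yxg ⊕ yu)) refl _ _ _ _ ⟩
      (x * v + c) + (y * (x * g) + y * u) ≈⟨ +-congˡ (sym (distribˡ y _ _)) ⟩
      (x * v + c) + y * (x * g + u)       ∎

  twoIndex-empty : ∀ a → twoIndex a 0 ≈ 0#
  twoIndex-empty a = trans (∑-cong a (λ i → zeroʳ _)) (∑-zeros a)

-- The multiple sum  X λ = ∑_{i₁..i_s ≥ 1} R_{i₁+⋯+i_s} q_{λ₁-i₁} ⋯ q_{λ_s-i_s}
-- satisfies, for λ = (a, m, b+1), the recursion
--   X(a, m, b+1) + q_a X(m, b+1) = X(a+1, m, b) + q_b X(a+1, m),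
-- the exchange identity for G = multiSum m, once the last index is summed last.
module MultipleSum {a ℓ : Level} (A : CommutativeRing a ℓ)
                   (Rs q : ℕ → CommutativeRing.Carrier A) where
  open CommutativeRing A
  open import Relation.Binary.Reasoning.Setoid setoid
  open FiniteSums A
  open Algebra.Properties.CommutativeSemigroup *-commutativeSemigroup
    using () renaming (x∙yz≈y∙xz to *-swapˡ)

  X : List ℕ → Carrier
  X λp = multiSum A Rs q λp 0

  -- Summing over the last index last (Fubini, applied once per part).
  multiSum-snoc : ∀ m b K → multiSum A Rs q (m ++ b ∷ []) K
                          ≈ ∑ b (λ j → q (b ∸ j) * multiSum A Rs q m (K ℕ.+ j))
  multiSum-snoc []      b K = refl
  multiSum-snoc (l ∷ m) b K = begin
    ∑ l (λ i → q (l ∸ i) * M (m ++ b ∷ []) (K ℕ.+ i))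
      ≈⟨ ∑-cong l (λ i → trans (*-congˡ (multiSum-snoc m b (K ℕ.+ i))) (*-∑ b _ _)) ⟩
    ∑ l (λ i → ∑ b (λ j → q (l ∸ i) * (q (b ∸ j) * M m (K ℕ.+ i ℕ.+ j))))
      ≈⟨ ∑-comm l b _ ⟩
    ∑ b (λ j → ∑ l (λ i → q (l ∸ i) * (q (b ∸ j) * M m (K ℕ.+ i ℕ.+ j))))
      ≈⟨ ∑-cong b (λ j → ∑-cong l (λ i → trans (*-swapˡ _ _ _)
                      (*-congˡ (*-congˡ (reflexive (≡.cong (M m) (ℕ+.xy∙z≈xz∙y K i j))))))) ⟩
    ∑ b (λ j → ∑ l (λ i → q (b ∸ j) * (q (l ∸ i) * M m (K ℕ.+ j ℕ.+ i))))
      ≈⟨ ∑-cong b (λ j → sym (*-∑ l _ _)) ⟩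
    ∑ b (λ j → q (b ∸ j) * M (l ∷ m) (K ℕ.+ j)) ∎
    where
    M = multiSum A Rs q
    module ℕ+ = Algebra.Properties.CommutativeSemigroup ℕP.+-commutativeSemigroup

  private
    module Ex (m : List ℕ) = Exchange A q (multiSum A Rs q m)

  X-twoIndex : ∀ a m b → X (a ∷ m ++ b ∷ []) ≈ Ex.twoIndex m a b
  X-twoIndex a m b = ∑-cong a (λ i → *-congˡ (multiSum-snoc m b i))

  X-oneIndex : ∀ m b → X (m ++ b ∷ []) ≈ Ex.oneIndex m b
  X-oneIndex m b = multiSum-snoc m b 0

  X-recursion : ∀ a m b → X (a ∷ m ++ suc b ∷ []) + q a * X (m ++ suc b ∷ [])
                        ≈ X (suc a ∷ m ++ b ∷ []) + q b * X (suc a ∷ m)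
  X-recursion a m b = begin
    X (a ∷ m ++ suc b ∷ []) + q a * X (m ++ suc b ∷ [])
      ≈⟨ +-cong (X-twoIndex a m (suc b)) (*-congˡ (X-oneIndex m (suc b))) ⟩
    Ex.twoIndex m a (suc b) + q a * Ex.oneIndex m (suc b)
      ≈⟨ Ex.exchange m a b ⟩
    Ex.twoIndex m (suc a) b + q b * Ex.oneIndex m (suc a)
      ≈⟨ +-congʳ (sym (X-twoIndex (suc a) m b)) ⟩
    X (suc a ∷ m ++ b ∷ []) + q b * X (suc a ∷ m) ∎

  -- A last part 0 leaves an empty range for the last index.
  X-vanishes : ∀ a m → X (a ∷ m ++ 0 ∷ []) ≈ 0#
  X-vanishes a m = trans (X-twoIndex a m 0) (Ex.twoIndex-empty m a)

module Partitions where

  -- Weakly decreasing lists are the sorted lists for the reversed order on ℕ;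
  -- adding a part to a partition is insertion sort's `insert` for that order.
  ≥-order : DecTotalOrder 0ℓ 0ℓ 0ℓ
  ≥-order = Flip.decTotalOrder ℕP.≤-decTotalOrder

  open import Data.List.Sort.InsertionSort.Base ≥-order using (insert) public
  open import Data.List.Sort.InsertionSort.Properties ≥-order using (insert-↗; insert-↭) public

  Decreasing : List ℕ → Set
  Decreasing = Linked (λ x y → y ≤ x)

  insert-≥ : ∀ {x y} ys → y ≤ x → insert x (y ∷ ys) ≡ x ∷ y ∷ ys
  insert-≥ {x} {y} ys y≤x with y ℕ.≤ᵇ x | ℕP.≤⇒≤ᵇ y≤x
  ... | true | _ = ≡.refl

  insert-< : ∀ {x y} ys → x < y → insert x (y ∷ ys) ≡ y ∷ insert x ys
  insert-< {x} {y} ys x<y with y ℕ.≤ᵇ x | ℕP.≤ᵇ⇒≤ y x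
  ... | true  | sound = ⊥-elim (ℕP.<⇒≱ x<y (sound _))
  ... | false | _     = ≡.refl

  addPart : ℕ → List ℕ → List ℕ
  addPart zero    μ = μ
  addPart (suc x) μ = insert (suc x) μ

  addPart-partition : ∀ x {μ} → IsPartition μ → IsPartition (addPart x μ)
  addPart-partition zero    pμ         = pμ
  addPart-partition (suc x) (dec , pos) =
    insert-↗ (suc x) dec , ↭P.All-resp-↭ (↭-sym (insert-↭ (suc x) _)) (s≤s z≤n ∷ pos)

  addPart-weight : ∀ x μ → weight (addPart x μ) ≡ x ℕ.+ weight μ
  addPart-weight zero    μ = ≡.refl
  addPart-weight (suc x) μ = sum-↭ (insert-↭ (suc x) μ)

  -- Inserting into two partitions with the same result: they were equal,
  -- as sorted lists are determined by their multiset of entries.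
  addPart-injective : ∀ x {μ ν} → Decreasing μ → Decreasing ν →
                      addPart x μ ≡ addPart x ν → μ ≡ ν
  addPart-injective zero    _    _    eq = eq
  addPart-injective (suc x) decμ decν eq =
    Pointwise-≡⇒≡ (Pointwise.map ≡.sym
      (↗↭↗⇒≋ (DecTotalOrder.totalOrder ≥-order) decμ decν
        (↭⇒↭ₛ′ (DecTotalOrder.isEquivalence ≥-order) μ↭ν)))
    where
    μ↭ν = ↭P.drop-∷ (↭-trans (↭-sym (insert-↭ (suc x) _))
                  (↭-trans (↭-reflexive eq) (insert-↭ (suc x) _)))

  addPart-largest : ∀ {a} l → 1 ≤ a → Decreasing (a ∷ l) → addPart a l ≡ a ∷ l
  addPart-largest {suc a} []      _ _         = ≡.refl
  addPart-largest {suc a} (y ∷ l) _ (y≤a ∷ _) = insert-≥ l y≤a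

  insert-smallest : ∀ x l → All (x <_) l → insert x l ≡ l ++ x ∷ []
  insert-smallest x []      []           = ≡.refl
  insert-smallest x (y ∷ l) (x<y ∷ x<l) =
    ≡.trans (insert-< l x<y) (≡.cong (y ∷_) (insert-smallest x l x<l))

  decreasing-snoc⁻ : ∀ l {z} → Decreasing (l ++ z ∷ []) → Decreasing l × All (z ≤_) l
  decreasing-snoc⁻ []           _              = [] , []
  decreasing-snoc⁻ (y ∷ [])     (z≤y ∷ [-])    = [-] , z≤y ∷ []
  decreasing-snoc⁻ (y ∷ y′ ∷ l) (y′≤y ∷ rest) with decreasing-snoc⁻ (y′ ∷ l) rest
  ... | dec , (z≤y′ ∷ z≤l) = y′≤y ∷ dec , ℕP.≤-trans z≤y′ y′≤y ∷ z≤y′ ∷ z≤l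

  decreasing-snoc⁺ : ∀ l {z} → Decreasing l → All (z ≤_) l → Decreasing (l ++ z ∷ [])
  decreasing-snoc⁺ []           []          []        = [-]
  decreasing-snoc⁺ (y ∷ [])     [-]         (z≤y ∷ _) = z≤y ∷ [-]
  decreasing-snoc⁺ (y ∷ y′ ∷ l) (y′≤y ∷ dec) (_ ∷ z≤l) = y′≤y ∷ decreasing-snoc⁺ (y′ ∷ l) dec z≤l

  decreasing-raise : ∀ {a} l → Decreasing (a ∷ l) → Decreasing (suc a ∷ l)
  decreasing-raise []      [-]         = [-]
  decreasing-raise (y ∷ l) (y≤a ∷ dec) = ℕP.m≤n⇒m≤1+n y≤a ∷ dec

  weight-snoc : ∀ l z → weight (l ++ z ∷ []) ≡ z ℕ.+ weight l
  weight-snoc l z = sum-↭ (↭P.++-comm l (z ∷ []))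

  length-snoc : ∀ (l : List ℕ) z → length (l ++ z ∷ []) ≡ suc (length l)
  length-snoc l z = ≡.trans (ListP.length-++ l) (ℕP.+-comm (length l) 1)

  lastPart-snoc : ∀ l z → lastPart (l ++ z ∷ []) ≡ z
  lastPart-snoc []           z = ≡.refl
  lastPart-snoc (y ∷ [])     z = ≡.refl
  lastPart-snoc (y ∷ y′ ∷ l) z = lastPart-snoc (y′ ∷ l) z

  dominates-refl : ∀ μ → Dominates μ μ
  dominates-refl μ i = ℕP.≤-refl

  dominates-trans : ∀ {μ ν ρ} → Dominates μ ν → Dominates ν ρ → Dominates μ ρ
  dominates-trans μ≥ν ν≥ρ i = ℕP.≤-trans (ν≥ρ i) (μ≥ν i)

  partialSum-next : ∀ y ys i → Decreasing (y ∷ ys) →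
                    partialSum (y ∷ ys) (suc i) ≤ y ℕ.+ partialSum (y ∷ ys) i
  partialSum-next y ys       zero    _          = ℕP.≤-refl
  partialSum-next y []       (suc i) _          = ℕP.+-monoʳ-≤ y z≤n
  partialSum-next y (z ∷ zs) (suc i) (z≤y ∷ dec) =
    ℕP.+-monoʳ-≤ y (ℕP.≤-trans (partialSum-next z zs i dec) (ℕP.+-monoˡ-≤ _ z≤y))

  -- The first i+1 parts after inserting x: either x is not among them, or it
  -- is, together with the first i old parts; sortedness picks the larger sum.
  partialSum-insert : ∀ x ν i → Decreasing ν →
    partialSum (insert x ν) (suc i) ≡ partialSum ν (suc i) ℕ.⊔ (x ℕ.+ partialSum ν i)
  partialSum-insert x []       i       _   = ≡.refl
  partialSum-insert x (y ∷ ys) i       dec with y ≤? x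
  partialSum-insert x (y ∷ ys) i       dec | yes y≤x
    rewrite insert-≥ ys y≤x =
    ≡.sym (ℕP.m≤n⇒m⊔n≡n (ℕP.≤-trans (partialSum-next y ys i dec) (ℕP.+-monoˡ-≤ _ y≤x)))
  partialSum-insert x (y ∷ ys) zero    dec | no y≰x
    rewrite insert-< ys (ℕP.≰⇒> y≰x) =
    ≡.sym (ℕP.m≥n⇒m⊔n≡m (ℕP.+-monoˡ-≤ 0 (ℕP.<⇒≤ (ℕP.≰⇒> y≰x))))
  partialSum-insert x (y ∷ ys) (suc i) dec | no y≰x
    rewrite insert-< ys (ℕP.≰⇒> y≰x) = begin
      y ℕ.+ partialSum (insert x ys) (suc i)
        ≡⟨ ≡.cong (y ℕ.+_) (partialSum-insert x ys i (Linked.tail dec)) ⟩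
      y ℕ.+ (partialSum ys (suc i) ℕ.⊔ (x ℕ.+ partialSum ys i))
        ≡⟨ ℕP.+-distribˡ-⊔ y _ _ ⟩
      (y ℕ.+ partialSum ys (suc i)) ℕ.⊔ (y ℕ.+ (x ℕ.+ partialSum ys i))
        ≡⟨ ≡.cong ((y ℕ.+ partialSum ys (suc i)) ℕ.⊔_) (ℕ+.x∙yz≈y∙xz y x _) ⟩
      (y ℕ.+ partialSum ys (suc i)) ℕ.⊔ (x ℕ.+ (y ℕ.+ partialSum ys i)) ∎
    where open ≡.≡-Reasoning
          module ℕ+ = Algebra.Properties.CommutativeSemigroup ℕP.+-commutativeSemigroup

  dominates-addPart : ∀ x {ν ρ} → Decreasing ν → Decreasing ρ →
                      Dominates ν ρ → Dominates (addPart x ν) (addPart x ρ)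
  dominates-addPart zero    _    _    ν≥ρ         = ν≥ρ
  dominates-addPart (suc x) decν decρ ν≥ρ zero    = z≤n
  dominates-addPart (suc x) decν decρ ν≥ρ (suc i) =
    ≡.subst₂ _≤_ (≡.sym (partialSum-insert (suc x) _ i decρ)) (≡.sym (partialSum-insert (suc x) _ i decν))
      (ℕP.⊔-mono-≤ (ν≥ρ (suc i)) (ℕP.+-monoʳ-≤ (suc x) (ν≥ρ i)))

  partialSum-snoc0 : ∀ l i → partialSum (l ++ 0 ∷ []) i ≡ partialSum l i
  partialSum-snoc0 l       zero    = ≡.refl
  partialSum-snoc0 []      (suc i) = partialSum-[] i
    where
    partialSum-[] : ∀ i → partialSum [] i ≡ 0
    partialSum-[] zero    = ≡.refl
    partialSum-[] (suc i) = ≡.refl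
  partialSum-snoc0 (y ∷ l) (suc i) = ≡.cong (y ℕ.+_) (partialSum-snoc0 l i)

  addPart-smallest : ∀ b ρ → All (b <_) ρ → Dominates (addPart b ρ) (ρ ++ b ∷ [])
  addPart-smallest zero    ρ _   i = ℕP.≤-reflexive (partialSum-snoc0 ρ i)
  addPart-smallest (suc b) ρ b<ρ i =
    ℕP.≤-reflexive (≡.cong (λ l → partialSum l i) (≡.sym (insert-smallest (suc b) ρ b<ρ)))

  dominates-moveBox : ∀ a m b → Dominates (suc a ∷ m ++ b ∷ []) (a ∷ m ++ suc b ∷ [])
  dominates-moveBox a m b zero    = z≤n
  dominates-moveBox a m b (suc i) =
    ℕP.≤-trans (ℕP.+-monoʳ-≤ a (lastBox m i)) (ℕP.≤-reflexive (ℕP.+-suc a _))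
    where
    lastBox : ∀ m i → partialSum (m ++ suc b ∷ []) i ≤ suc (partialSum (m ++ b ∷ []) i)
    lastBox m       zero    = z≤n
    lastBox []      (suc i) = s≤s ℕP.≤-refl
    lastBox (y ∷ m) (suc i) =
      ℕP.≤-trans (ℕP.+-monoʳ-≤ y (lastBox m i)) (ℕP.≤-reflexive (ℕP.+-suc y _))

  dominates-firstPart : ∀ {μ a r r′} → Dominates μ (suc a ∷ r) → ¬ a ∷ r′ ≡ μ
  dominates-firstPart μ≥ ≡.refl = ℕP.n≮n _ (μ≥ 1)

  -- The three partitions entering the recursion for λ = (a, m, b+1):
  --   moved   = (a+1, m, b)   (one box moved from the last to the first row),
  --   noLast  = (a+1, m),
  --   noFirst = (m, b+1).
  module Reductions (a : ℕ) (m : List ℕ) (b : ℕ)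
                    (pλ : IsPartition (a ∷ m ++ suc b ∷ [])) where

    private
      decλ  = proj₁ pλ
      posλ  = proj₂ pλ
      split = decreasing-snoc⁻ (a ∷ m) decλ
      posm  = AllP.++⁻ˡ m (All.tail posλ)

    noLast-partition : IsPartition (suc a ∷ m)
    noLast-partition = decreasing-raise m (proj₁ split) , s≤s z≤n ∷ posm

    noFirst-partition : IsPartition (m ++ suc b ∷ [])
    noFirst-partition = Linked.tail decλ , All.tail posλ

    moved-partition : 1 ≤ b → IsPartition (suc a ∷ m ++ b ∷ [])
    moved-partition 1≤b =
      decreasing-raise (m ++ b ∷ [])
        (decreasing-snoc⁺ (a ∷ m) (proj₁ split) (All.map ℕP.<⇒≤ (proj₂ split)))
      , s≤s z≤n ∷ AllP.++⁺ posm (1≤b ∷ [])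

    noLast-above : All (b <_) (suc a ∷ m)
    noLast-above with proj₂ split
    ... | b<a ∷ b<m = ℕP.m≤n⇒m≤1+n b<a ∷ b<m

    addPart-noFirst : addPart a (m ++ suc b ∷ []) ≡ a ∷ m ++ suc b ∷ []
    addPart-noFirst = addPart-largest (m ++ suc b ∷ []) (All.head posλ) decλ

    moved-weight : weight (suc a ∷ m ++ b ∷ []) ≡ weight (a ∷ m ++ suc b ∷ [])
    moved-weight = begin
      suc a ℕ.+ weight (m ++ b ∷ [])      ≡⟨ ≡.cong (suc a ℕ.+_) (weight-snoc m b) ⟩
      suc a ℕ.+ (b ℕ.+ weight m)          ≡⟨ ℕP.+-suc a _ ⟨
      a ℕ.+ (suc b ℕ.+ weight m)          ≡⟨ ≡.cong (a ℕ.+_) (weight-snoc m (suc b)) ⟨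
      a ℕ.+ weight (m ++ suc b ∷ [])      ∎
      where open ≡.≡-Reasoning

    noLast-weight : b ℕ.+ weight (suc a ∷ m) ≡ weight (suc a ∷ m ++ b ∷ [])
    noLast-weight = ≡.sym (weight-snoc (suc a ∷ m) b)

open Partitions

module IntegerSpan {c ℓ : Level} (F : CommutativeRing c ℓ) where
  open CommutativeRing F
  open import Relation.Binary.Reasoning.Setoid setoid
  open RingProperties ring using (-0#≈0#; -‿+-comm; -‿involutive)
  open Algebra.Properties.CommutativeSemigroup +-commutativeSemigroup
    using () renaming (interchange to +-interchange; x∙yz≈y∙xz to +-swapˡ)

  natScale-+ : ∀ m n x → natScale F (m ℕ.+ n) x ≈ natScale F m x + natScale F n x
  natScale-+ m zero    x =
    trans (reflexive (≡.cong (λ k → natScale F k x) (ℕP.+-identityʳ m))) (sym (+-identityʳ _))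
  natScale-+ m (suc n) x = begin
    natScale F (m ℕ.+ suc n) x        ≡⟨ ≡.cong (λ k → natScale F k x) (ℕP.+-suc m n) ⟩
    natScale F (m ℕ.+ n) x + x        ≈⟨ +-congʳ (natScale-+ m n x) ⟩
    (natScale F m x + natScale F n x) + x ≈⟨ +-assoc _ _ _ ⟩
    natScale F m x + (natScale F n x + x) ∎

  intScale-⊖ : ∀ m n x → intScale F (m ⊖ n) x ≈ natScale F m x - natScale F n x
  intScale-⊖ m       zero    x = sym (trans (+-congˡ -0#≈0#) (+-identityʳ _))
  intScale-⊖ zero    (suc n) x = sym (+-identityˡ _)
  intScale-⊖ (suc m) (suc n) x = begin
    intScale F (suc m ⊖ suc n) x         ≡⟨ ≡.cong (λ z → intScale F z x) (ℤP.[1+m]⊖[1+n]≡m⊖n m n) ⟩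
    intScale F (m ⊖ n) x                 ≈⟨ intScale-⊖ m n x ⟩
    natScale F m x - natScale F n x      ≈⟨ sym (+-cancel x) ⟩
    (natScale F m x + x) - (natScale F n x + x) ∎
    where
    +-cancel : ∀ x → (natScale F m x + x) - (natScale F n x + x) ≈ natScale F m x - natScale F n x
    +-cancel x = begin
      (natScale F m x + x) - (natScale F n x + x)      ≈⟨ +-congˡ (sym (-‿+-comm _ _)) ⟩
      (natScale F m x + x) + (- natScale F n x + - x)  ≈⟨ +-interchange _ _ _ _ ⟩
      (natScale F m x - natScale F n x) + (x - x)      ≈⟨ +-congˡ (-‿inverseʳ x) ⟩
      (natScale F m x - natScale F n x) + 0#           ≈⟨ +-identityʳ _ ⟩
      natScale F m x - natScale F n x                  ∎

  intScale-+ : ∀ z w x → intScale F (z ℤ.+ w) x ≈ intScale F z x + intScale F w x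
  intScale-+ (+ m)    (+ n)    x = natScale-+ m n x
  intScale-+ (+ m)    -[1+ n ] x = intScale-⊖ m (suc n) x
  intScale-+ -[1+ m ] (+ n)    x = trans (intScale-⊖ n (suc m) x) (+-comm _ _)
  intScale-+ -[1+ m ] -[1+ n ] x = begin
    - natScale F (suc (suc (m ℕ.+ n))) x              ≈⟨ -‿cong (+-congʳ (natScale-+ (suc m) n x)) ⟩
    - ((natScale F (suc m) x + natScale F n x) + x)   ≈⟨ -‿cong (+-assoc _ _ _) ⟩
    - (natScale F (suc m) x + natScale F (suc n) x)   ≈⟨ sym (-‿+-comm _ _) ⟩
    - natScale F (suc m) x + - natScale F (suc n) x   ∎

  intScale-neg : ∀ z x → intScale F (ℤ.- z) x ≈ - intScale F z x
  intScale-neg (+ zero)  x = sym -0#≈0#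
  intScale-neg (+ suc n) x = refl
  intScale-neg -[1+ n ]  x = sym (-‿involutive _)

  Span : Carrier → List Carrier → Set ℓ
  Span = IsIntLinComb F

  span-generator : ∀ x → Span x (x ∷ [])
  span-generator x = (+ 1 ∷ []) , ≡.refl , sym (trans (+-identityʳ _) (+-identityˡ _))

  span-+ : ∀ {a b xs} → Span a xs → Span b xs → Span (a + b) xs
  span-+ {xs = xs} (zs , |zs| , a≈) (ws , |ws| , b≈) =
    zipWith ℤ._+_ zs ws , length-zip zs ws xs |zs| |ws| , trans (+-cong a≈ b≈) (sym (combine zs ws xs |zs| |ws|))
    where
    length-zip : ∀ zs ws (xs : List Carrier) → length zs ≡ length xs → length ws ≡ length xs →
                 length (zipWith ℤ._+_ zs ws) ≡ length xs
    length-zip []       []       []       _ _ = ≡.refl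
    length-zip (z ∷ zs) (w ∷ ws) (x ∷ xs) e f =
      ≡.cong suc (length-zip zs ws xs (ℕP.suc-injective e) (ℕP.suc-injective f))
    combine : ∀ zs ws xs → length zs ≡ length xs → length ws ≡ length xs →
              intLinComb F (zipWith ℤ._+_ zs ws) xs ≈ intLinComb F zs xs + intLinComb F ws xs
    combine []       []       []       _ _ = sym (+-identityˡ _)
    combine (z ∷ zs) (w ∷ ws) (x ∷ xs) e f =
      trans (+-cong (intScale-+ z w x) (combine zs ws xs (ℕP.suc-injective e) (ℕP.suc-injective f)))
            (+-interchange _ _ _ _)

  span-neg : ∀ {a xs} → Span a xs → Span (- a) xs
  span-neg {xs = xs} (zs , |zs| , a≈) =
    map ℤ.-_ zs , ≡.trans (ListP.length-map ℤ.-_ zs) |zs| , trans (-‿cong a≈) (sym (negate zs xs))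
    where
    negate : ∀ zs xs → intLinComb F (map ℤ.-_ zs) xs ≈ - intLinComb F zs xs
    negate []       xs       = sym -0#≈0#
    negate (z ∷ zs) []       = sym -0#≈0#
    negate (z ∷ zs) (x ∷ xs) = trans (+-cong (intScale-neg z x) (negate zs xs)) (-‿+-comm _ _)

  span-cons : ∀ {a xs} y → Span a xs → Span a (y ∷ xs)
  span-cons y (zs , |zs| , a≈) = (+ 0 ∷ zs) , ≡.cong suc |zs| , trans a≈ (sym (+-identityˡ _))

  span-↭ : ∀ {xs ys} → xs ↭ ys → ∀ {a} → Span a xs → Span a ys
  span-↭ ↭.refl          s = s
  span-↭ (↭.trans p q)   s = span-↭ q (span-↭ p s)
  span-↭ (↭.prep x p)    (z ∷ zs , |zs| , a≈)
    with span-↭ p (zs , ℕP.suc-injective |zs| , refl)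
  ... | ws , |ws| , ≈ws = z ∷ ws , ≡.cong suc |ws| , trans a≈ (+-congˡ ≈ws)
  span-↭ (↭.swap x y p)  (z ∷ w ∷ zs , |zs| , a≈)
    with span-↭ p (zs , ℕP.suc-injective (ℕP.suc-injective |zs|) , refl)
  ... | ws , |ws| , ≈ws =
    w ∷ z ∷ ws , ≡.cong (λ n → suc (suc n)) |ws| , trans a≈ (trans (+-congˡ (+-congˡ ≈ws)) (+-swapˡ _ _ _))

module LinearCombinations
  {c ℓ a ℓ′ : Level} (F : CommutativeRing c ℓ) (A : CommutativeRing a ℓ′)
  (ι : CommutativeRing.Carrier F → CommutativeRing.Carrier A) (ι-alg : IsAlgebraMap F A ι)
  (q : ℕ → CommutativeRing.Carrier A) (q₀ : CommutativeRing._≈_ A (q 0) (CommutativeRing.1# A))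
  where

  open CommutativeRing A
  open RingProperties ring using (-0#≈0#; -‿+-comm; -‿distribˡ-*)
  open Algebra.Properties.CommutativeSemigroup *-commutativeSemigroup
    using () renaming (x∙yz≈y∙xz to *-swapˡ)
  open Algebra.Properties.CommutativeSemigroup +-commutativeSemigroup
    using () renaming (x∙yz≈y∙xz to +-swapˡ)
  private
    module F = CommutativeRing F
    module ι = IsRingHomomorphism (IsAlgebraMap.isRingHom ι-alg)

  Term : Set c
  Term = List ℕ × F.Carrier

  Σq : List Term → Carrier
  Σq = combo A F ι q

  qProd-↭ : ∀ {μ ν} → μ ↭ ν → qProd A q μ ≈ qProd A q ν
  qProd-↭ ↭.refl         = refl
  qProd-↭ (↭.prep x p)   = *-congˡ (qProd-↭ p)
  qProd-↭ (↭.swap x y p) = trans (*-congˡ (*-congˡ (qProd-↭ p))) (*-swapˡ _ _ _)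
  qProd-↭ (↭.trans p p′) = trans (qProd-↭ p) (qProd-↭ p′)

  -- Since q₀ = 1, adding any part x multiplies q_μ by q_x.
  qProd-addPart : ∀ x μ → qProd A q (addPart x μ) ≈ q x * qProd A q μ
  qProd-addPart zero    μ = sym (trans (*-congʳ q₀) (*-identityˡ _))
  qProd-addPart (suc x) μ = qProd-↭ (insert-↭ (suc x) μ)

  addPartTerm : ℕ → Term → Term
  addPartTerm x (μ , d) = addPart x μ , d

  negateTerm : Term → Term
  negateTerm (μ , d) = μ , F.- d

  Σq-++ : ∀ ts us → Σq (ts ++ us) ≈ Σq ts + Σq us
  Σq-++ []             us = sym (+-identityˡ _)
  Σq-++ ((μ , d) ∷ ts) us = trans (+-congˡ (Σq-++ ts us)) (sym (+-assoc _ _ _))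

  Σq-addPart : ∀ x ts → Σq (map (addPartTerm x) ts) ≈ q x * Σq ts
  Σq-addPart x []             = sym (zeroʳ _)
  Σq-addPart x ((μ , d) ∷ ts) =
    trans (+-cong (trans (*-congˡ (qProd-addPart x μ)) (*-swapˡ _ _ _)) (Σq-addPart x ts))
          (sym (distribˡ _ _ _))

  Σq-negate : ∀ ts → Σq (map negateTerm ts) ≈ - Σq ts
  Σq-negate []             = sym -0#≈0#
  Σq-negate ((μ , d) ∷ ts) =
    trans (+-cong (trans (*-congʳ (ι.-‿homo d)) (sym (-‿distribˡ-* _ _))) (Σq-negate ts))
          (-‿+-comm _ _)

  addTerm : Term → List Term → List Term
  addTerm t              []             = t ∷ []
  addTerm (μ , d) ((ν , e) ∷ ts) with ListP.≡-dec ℕP._≟_ μ ν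
  ... | yes _ = (ν , d F.+ e) ∷ ts
  ... | no  _ = (ν , e) ∷ addTerm (μ , d) ts

  collect : List Term → List Term
  collect = foldr addTerm []

  Σq-addTerm : ∀ μ d ts → Σq (addTerm (μ , d) ts) ≈ ι d * qProd A q μ + Σq ts
  Σq-addTerm μ d []             = refl
  Σq-addTerm μ d ((ν , e) ∷ ts) with ListP.≡-dec ℕP._≟_ μ ν
  ... | yes ≡.refl = trans (+-congʳ (trans (*-congʳ (ι.+-homo d e)) (distribʳ _ _ _))) (+-assoc _ _ _)
  ... | no  _      = trans (+-congˡ (Σq-addTerm μ d ts)) (+-swapˡ _ _ _)

  SumClosed : ∀ {p} → (Term → Set p) → Set (c ⊔ p)
  SumClosed P = ∀ {μ d e} → P (μ , d) → P (μ , e) → P (μ , d F.+ e)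

  addTerm-All : ∀ {p} {P : Term → Set p} → SumClosed P →
                ∀ {t ts} → P t → All P ts → All P (addTerm t ts)
  addTerm-All closed {t}     {[]}           Pt []          = Pt ∷ []
  addTerm-All closed {μ , d} {(ν , e) ∷ ts} Pt (Pν ∷ Pts) with ListP.≡-dec ℕP._≟_ μ ν
  ... | yes ≡.refl = closed Pt Pν ∷ Pts
  ... | no  _      = Pν ∷ addTerm-All closed Pt Pts

  addTerm-unique : ∀ t ts → Unique (map proj₁ ts) → Unique (map proj₁ (addTerm t ts))
  addTerm-unique t              []             []            = [] ∷ []
  addTerm-unique (μ , d) ((ν , e) ∷ ts) (ν∉ts ∷ uts) with ListP.≡-dec ℕP._≟_ μ ν
  ... | yes _   = ν∉ts ∷ uts
  ... | no  μ≢ν = ν∉ts′ ∷ addTerm-unique (μ , d) ts uts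
    where
    ν∉ts′ = AllP.map⁺ (addTerm-All (λ ν≢ _ → ν≢) (λ ν≡μ → μ≢ν (≡.sym ν≡μ)) (AllP.map⁻ ν∉ts))

  collect-Σq : ∀ ts → Σq (collect ts) ≈ Σq ts
  collect-Σq []             = refl
  collect-Σq ((μ , d) ∷ ts) = trans (Σq-addTerm μ d (collect ts)) (+-congˡ (collect-Σq ts))

  collect-All : ∀ {p} {P : Term → Set p} → SumClosed P → ∀ {ts} → All P ts → All P (collect ts)
  collect-All closed []         = []
  collect-All closed (Pt ∷ Pts) = addTerm-All closed Pt (collect-All closed Pts)

  collect-unique : ∀ ts → Unique (map proj₁ (collect ts))
  collect-unique []       = []
  collect-unique (t ∷ ts) = addTerm-unique t (collect ts) (collect-unique ts)

module Admissibility {c ℓ : Level} (F : CommutativeRing c ℓ) (cs : ℕ → CommutativeRing.Carrier F) where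
  open CommutativeRing F
  open IntegerSpan F

  Admissible : List ℕ → List ℕ × Carrier → Set ℓ
  Admissible λp t = IsPartition (proj₁ t) × weight (proj₁ t) ≡ weight λp
                    × Dominates (proj₁ t) λp × IsIntLinComb F (proj₂ t) (map cs (proj₁ t))

  Above : List ℕ → List ℕ × Carrier → Set ℓ
  Above λp t = Admissible λp t × ¬ λp ≡ proj₁ t

  above-sumClosed : ∀ {λp μ d e} → Above λp (μ , d) → Above λp (μ , e) → Above λp (μ , d + e)
  above-sumClosed ((pμ , wμ , dμ , sd) , λ≢μ) ((_ , _ , _ , se) , _) = (pμ , wμ , dμ , span-+ sd se) , λ≢μ

  admissible-lift : ∀ {ν λp t} → weight ν ≡ weight λp → Dominates ν λp → Admissible ν t → Admissible λp t
  admissible-lift wν ν≥λ (pμ , wμ , μ≥ν , sμ) = pμ , ≡.trans wμ wν , dominates-trans μ≥ν ν≥λ , sμ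

  span-addPart : ∀ x μ {d} → Span d (map cs μ) → Span d (map cs (addPart x μ))
  span-addPart zero    μ s = s
  span-addPart (suc x) μ s = span-↭ (↭-sym (↭P.map⁺ cs (insert-↭ (suc x) μ))) (span-cons (cs (suc x)) s)

  admissible-addPart : ∀ x {ν μ d} → IsPartition ν → Admissible ν (μ , d) →
                       Admissible (addPart x ν) (addPart x μ , d)
  admissible-addPart x {ν} {μ} pν (pμ , wμ , μ≥ν , sμ) =
    addPart-partition x pμ ,
    ≡.trans (addPart-weight x μ) (≡.trans (≡.cong (x ℕ.+_) wμ) (≡.sym (addPart-weight x ν))) ,
    dominates-addPart x (proj₁ pμ) (proj₁ pν) μ≥ν ,
    span-addPart x μ sμ

  admissible-negate : ∀ {ν μ d} → Admissible ν (μ , d) → Admissible ν (μ , - d)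
  admissible-negate (pμ , wμ , μ≥ν , sμ) = pμ , wμ , μ≥ν , span-neg sμ

module Expansions
  {c ℓ a ℓ′ : Level} (F : CommutativeRing c ℓ) (A : CommutativeRing a ℓ′)
  (ι : CommutativeRing.Carrier F → CommutativeRing.Carrier A) (ι-alg : IsAlgebraMap F A ι)
  (Rs q : ℕ → CommutativeRing.Carrier A) (q₀ : CommutativeRing._≈_ A (q 0) (CommutativeRing.1# A))
  (cs : ℕ → CommutativeRing.Carrier F)
  (recurrence : ∀ n → 1 ≤ n →
     CommutativeRing._≈_ A (sumFrom1 A n (λ i → CommutativeRing._*_ A (Rs i) (q (n ∸ i))))
                           (CommutativeRing._*_ A (ι (cs n)) (q n)))
  where

  private
    module F = CommutativeRing F
  open CommutativeRing A
  open import Relation.Binary.Reasoning.Setoid setoid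
  open RingProperties ring using (//-rightDividesʳ)
  open FiniteSums A
  open MultipleSum A Rs q
  open LinearCombinations F A ι ι-alg q q₀
  open Admissibility F cs
  open IntegerSpan F

  record Expansion (λp : List ℕ) : Set (c ⊔ ℓ ⊔ ℓ′) where
    field
      lead         : F.Carrier
      others       : List Term
      lead-span    : Span lead (map cs λp)
      lead-sign    : lead F.≈ signPow F (length λp ∸ 1) (cs (lastPart λp))
      others-above : All (Above λp) others
      expands      : X λp ≈ Σq ((λp , lead) ∷ others)

    terms : List Term
    terms = (λp , lead) ∷ others

    lead-admissible : IsPartition λp → Admissible λp (λp , lead)
    lead-admissible pλ = pλ , ≡.refl , dominates-refl λp , lead-span

    terms-admissible : IsPartition λp → All (Admissible λp) terms
    terms-admissible pλ = lead-admissible pλ ∷ All.map proj₁ others-above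

  single : ∀ x → 1 ≤ x → Expansion (x ∷ [])
  single x 1≤x = record
    { lead = cs x ; others = [] ; lead-span = span-generator (cs x) ; lead-sign = F.refl
    ; others-above = []
    ; expands = begin
        ∑ x (λ i → q (x ∸ i) * Rs i) ≈⟨ ∑-cong x (λ i → *-comm _ _) ⟩
        ∑ x (λ i → Rs i * q (x ∸ i)) ≈⟨ recurrence x 1≤x ⟩
        ι (cs x) * q x                ≈⟨ sym (trans (+-identityʳ _) (*-congˡ (*-identityʳ _))) ⟩
        ι (cs x) * (q x * 1#) + 0#    ∎
    }

  Upper : ℕ → List ℕ → ℕ → Set (c ⊔ ℓ ⊔ ℓ′)
  Upper a m b = Σ (List Term) λ ts → All (Above (a ∷ m ++ suc b ∷ [])) ts × X (suc a ∷ m ++ b ∷ []) ≈ Σq ts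

  -- The recursion step for λ = (a, m, b+1), from
  --   X λ = X(a+1, m, b) + q_b X(a+1, m) − q_a X(m, b+1).
  -- Terms of the first two summands dominate (a+1, m, b) and so lie above λ;
  -- in the last one q_a q_μ = q_{μ ∪ a}, which is q_λ exactly for μ = (m, b+1).
  module Step (a : ℕ) (m : List ℕ) (b : ℕ) (pλ : IsPartition (a ∷ m ++ suc b ∷ [])) where
    open Reductions a m b pλ

    λp moved noLast noFirst : List ℕ
    λp      = a ∷ m ++ suc b ∷ []
    moved   = suc a ∷ m ++ b ∷ []
    noLast  = suc a ∷ m
    noFirst = m ++ suc b ∷ []

    above-moved : ∀ {t} → Admissible moved t → Above λp t
    above-moved adm@(_ , _ , μ≥moved , _) =
      admissible-lift moved-weight (dominates-moveBox a m b) adm , dominates-firstPart μ≥moved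

    -- The terms of q_b X(a+1, m) dominate (a+1, m) ∪ b = (a+1, m, b).
    above-noLast : ∀ {t} → Admissible noLast t → Above λp (addPartTerm b t)
    above-noLast {μ , d} adm =
      above-moved (admissible-lift (≡.trans (addPart-weight b noLast) noLast-weight)
                                   (addPart-smallest b noLast noLast-above)
                                   (admissible-addPart b noLast-partition adm))

    -- Adding a to the terms of X(m, b+1) other than (m, b+1) gives terms
    -- other than λ, as adding a part is injective.
    above-noFirst : ∀ {t} → Above noFirst t → Above λp (negateTerm (addPartTerm a t))
    above-noFirst {μ , d} (adm@(pμ , _) , noFirst≢μ) =
      ≡.subst (λ ν → Admissible ν _) addPart-noFirst (admissible-negate (admissible-addPart a noFirst-partition adm)) ,
      λ λ≡μ → noFirst≢μ (addPart-injective a (proj₁ noFirst-partition) (proj₁ pμ)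
                                            (≡.trans addPart-noFirst λ≡μ))

    -- λ has one part more than (m, b+1) and the same last part.
    sign : ∀ {l} → l F.≈ signPow F (length noFirst ∸ 1) (cs (lastPart noFirst)) →
           F.- l F.≈ signPow F (length λp ∸ 1) (cs (lastPart λp))
    sign {l} l≈ = ≡.subst (λ z → F.- l F.≈ signPow F (length noFirst) (cs z)) lastParts
                    (negate-signPow (length noFirst) 1≤length (F.-‿cong l≈))
      where
      lastParts : lastPart noFirst ≡ lastPart λp
      lastParts = ≡.trans (lastPart-snoc m (suc b)) (≡.sym (lastPart-snoc (a ∷ m) (suc b)))
      1≤length : 1 ≤ length noFirst
      1≤length = ≡.subst (1 ≤_) (≡.sym (length-snoc m (suc b))) (s≤s z≤n)
      negate-signPow : ∀ k → 1 ≤ k → ∀ {x y} → x F.≈ F.- signPow F (k ∸ 1) y → x F.≈ signPow F k y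
      negate-signPow (suc k) _ x≈ = x≈

    assemble : Expansion noLast → Expansion noFirst → Upper a m b → Expansion λp
    assemble E₂ E₃ (upper , upper-above , upper-expands) = record
      { lead         = F.- E₃.lead
      ; others       = upper ++ fromNoLast ++ fromNoFirst
      ; lead-span    = ≡.subst (λ ν → Span (F.- E₃.lead) (map cs ν)) addPart-noFirst
                         (span-neg (span-addPart a noFirst E₃.lead-span))
      ; lead-sign    = sign E₃.lead-sign
      ; others-above = AllP.++⁺ upper-above (AllP.++⁺
                         (AllP.map⁺ (All.map above-noLast (E₂.terms-admissible noLast-partition)))
                         (AllP.map⁺ (AllP.map⁺ (All.map above-noFirst E₃.others-above))))
      ; expands      = expands
      }
      where
      module E₂ = Expansion E₂
      module E₃ = Expansion E₃
      fromNoLast fromNoFirst : List Term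
      fromNoLast  = map (addPartTerm b) E₂.terms
      fromNoFirst = map negateTerm (map (addPartTerm a) E₃.others)

      shift : ∀ ts → - (q a * Σq ts) ≈ Σq (map negateTerm (map (addPartTerm a) ts))
      shift ts = sym (trans (Σq-negate (map (addPartTerm a) ts)) (-‿cong (Σq-addPart a ts)))

      expands : X λp ≈ Σq ((λp , F.- E₃.lead) ∷ upper ++ fromNoLast ++ fromNoFirst)
      expands = begin
        X λp
          ≈⟨ solveFor (X-recursion a m b) ⟩
        (X moved + q b * X noLast) - q a * X noFirst
          ≈⟨ +-cong (+-cong upper-expands (trans (*-congˡ E₂.expands) (sym (Σq-addPart b E₂.terms))))
                    (trans (-‿cong (*-congˡ E₃.expands)) (shift E₃.terms)) ⟩
        (Σq upper + Σq fromNoLast) + (ι (F.- E₃.lead) * qProd A q (addPart a noFirst) + Σq fromNoFirst)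
          ≈⟨ +-congˡ (+-congʳ (*-congˡ (reflexive (≡.cong (qProd A q) addPart-noFirst)))) ⟩
        (Σq upper + Σq fromNoLast) + (ι (F.- E₃.lead) * qProd A q λp + Σq fromNoFirst)
          ≈⟨ CM.solve 4 (λ u v l w → (u ⊕ v) ⊕ (l ⊕ w) ⊜ l ⊕ (u ⊕ (v ⊕ w))) refl _ _ _ _ ⟩
        ι (F.- E₃.lead) * qProd A q λp + (Σq upper + (Σq fromNoLast + Σq fromNoFirst))
          ≈⟨ +-congˡ (sym (trans (Σq-++ upper _) (+-congˡ (Σq-++ fromNoLast fromNoFirst)))) ⟩
        Σq ((λp , F.- E₃.lead) ∷ upper ++ fromNoLast ++ fromNoFirst) ∎
        where
        module CM = CommutativeMonoidSolver +-commutativeMonoid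
        open CM using (_⊕_; _⊜_)
        solveFor : ∀ {u v w} → u + v ≈ w → u ≈ w - v
        solveFor {u} {v} e = trans (sym (//-rightDividesʳ v u)) (+-congʳ e)

  expansion     : ∀ n λp → length λp ≡ suc n → IsPartition λp → Expansion λp
  expansionStep : ∀ n a m b → length m ≡ n → IsPartition (a ∷ m ++ suc b ∷ []) →
                  Expansion (a ∷ m ++ suc b ∷ [])
  upperTerms    : ∀ n a m b → length m ≡ n → IsPartition (a ∷ m ++ suc b ∷ []) → Upper a m b

  expansion zero    (x ∷ []) ≡.refl (_ , 1≤x ∷ []) = single x 1≤x
  expansion (suc n) (x ∷ r)  len    pλ with initLast r
  ... | []          = ⊥-elim (ℕP.1+n≢0 (ℕP.suc-injective (≡.sym len)))
  ... | m ∷ʳ′ zero  = ⊥-elim (ℕP.1+n≰n (All.head (AllP.++⁻ʳ m (All.tail (proj₂ pλ)))))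
  ... | m ∷ʳ′ suc b =
    expansionStep n x m b (ℕP.suc-injective (≡.trans (≡.sym (length-snoc m (suc b))) (ℕP.suc-injective len))) pλ

  expansionStep n a m b |m| pλ = Step.assemble a m b pλ
    (expansion n (suc a ∷ m) (≡.cong suc |m|) noLast-partition)
    (expansion n (m ++ suc b ∷ []) (≡.trans (length-snoc m (suc b)) (≡.cong suc |m|)) noFirst-partition)
    (upperTerms n a m b |m| pλ)
    where open Reductions a m b pλ

  upperTerms n a m zero    |m| pλ = [] , [] , X-vanishes (suc a) m
  upperTerms n a m (suc b) |m| pλ =
    terms , All.map above-moved (terms-admissible (moved-partition (s≤s z≤n))) , expands
    where
    open Reductions a m (suc b) pλ
    open Step a m (suc b) pλ using (above-moved)
    open Expansion (expansionStep n (suc a) m b |m| (moved-partition (s≤s z≤n)))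

  normalForm : ∀ {λp} → IsPartition λp → Expansion λp →
    Σ (List Term) λ terms →
      All (Admissible λp) terms × Unique (map proj₁ terms)
      × Σ F.Carrier (λ cλλ → (λp , cλλ) ∈ terms
                             × cλλ F.≈ signPow F (length λp ∸ 1) (cs (lastPart λp)))
      × X λp ≈ Σq terms
  normalForm {λp} pλ E =
    (λp , lead) ∷ collect others ,
    lead-admissible pλ ∷ All.map proj₁ collected ,
    AllP.map⁺ (All.map proj₂ collected) ∷ collect-unique others ,
    (lead , here ≡.refl , lead-sign) ,
    trans expands (+-congˡ (sym (collect-Σq others)))
    where
    open Expansion E
    collected = collect-All above-sumClosed others-above

mainTheorem1 : ∀ {c ℓ a ℓ′ : Level}
    (F : CommutativeRing c ℓ) → IsField F →
    (A : CommutativeRing a ℓ′) →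
    (ι : CommutativeRing.Carrier F → CommutativeRing.Carrier A) → IsAlgebraMap F A ι →
    (Rs q : ℕ → CommutativeRing.Carrier A) →
    CommutativeRing._≈_ A (q 0) (CommutativeRing.1# A) →
    (cs : ℕ → CommutativeRing.Carrier F) →
    (∀ n → 1 ≤ n →
      CommutativeRing._≈_ A
        (sumFrom1 A n (λ i → CommutativeRing._*_ A (Rs i) (q (n ∸ i))))
        (CommutativeRing._*_ A (ι (cs n)) (q n))) →
    (λp : List ℕ) → IsPartition λp → 1 ≤ length λp →
    Σ (List (List ℕ × CommutativeRing.Carrier F)) λ terms →
      All (λ t → IsPartition (proj₁ t) × weight (proj₁ t) ≡ weight λp
                 × Dominates (proj₁ t) λp
                 × IsIntLinComb F (proj₂ t) (map cs (proj₁ t))) terms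
      × Unique (map proj₁ terms)
      × Σ (CommutativeRing.Carrier F) (λ cλλ →
          (λp , cλλ) ∈ terms
          × CommutativeRing._≈_ F cλλ (signPow F (length λp ∸ 1) (cs (lastPart λp))))
      × CommutativeRing._≈_ A (multiSum A Rs q λp 0) (combo A F ι q terms)
mainTheorem1 F _ A ι ι-alg Rs q q₀ cs recurrence (x ∷ xs) pλ _ =
  normalForm pλ (expansion (length xs) (x ∷ xs) ≡.refl pλ)
  where open Expansions F A ι ι-alg Rs q q₀ cs recurrence
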